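{- Let $N$ be a rooted phylogenetic network (RPN) over a finite taxon set $X$ with $|X|=n$, and assume that $N$ has no redundant nodes, i.e. $\mathcal{D}(N)=\emptyset$. Suppose $N$ has exactly $p$ tree-node components and exactly $q$ reticulation components. Then $$p-1\le q\le n+p-1.$$
   Context: An RPN over a finite set $X$ of taxa is a finite acyclic directed graph $N$ with a unique node of indegree $0$ (the root, which has outdegree at least $1$), all edges directed away from the root, such that every non-root node has indegree $1$ or outdegree $1$, and the nodes of indegree $1$ and outdegree $0$ (the leaves) are bijectively labelled by the elements of $X$. A non-leaf node of indegree at least $2$ (and outdegree $1$) is a reticulate node; a tree node is either the root or a node of indegree $1$ and outdegree at least $2$; a redundant node is a node of indegree $1$ and outdegree $1$. $\mathcal{T}(N),\mathcal{R}(N),\mathcal{D}(N),\mathcal{L}(N)$ denote the sets of tree nodes, reticulate nodes, redundant nodes and leaves. The tree-node components of $N$ are the connected components of the subgraph of $N$ induced by $\mathcal{T}(N)$; the reticulation components are the connected components of the subgraph induced by $\mathcal{R}(N)$. -}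

module Defs where

open import Data.Nat using (ℕ; zero; suc; _+_; _≤_)
open import Data.Fin using (Fin)
open import Data.Bool using (Bool; true; false)
open import Data.List using (List; filter; length)
open import Data.List.Base using (allFin)
open import Data.Product using (Σ; ∃; _×_; _,_)
open import Data.Sum using (_⊎_)
open import Relation.Binary.PropositionalEquality using (_≡_)
open import Relation.Nullary using (¬_)
open import Relation.Nullary.Decidable using (Dec)
open import Data.Bool.Properties using () renaming (_≟_ to _≟B_)
open import Function.Bundles using (_⇔_)

-- A finite simple directed graph on node set Fin m, edges given by a
-- Boolean adjacency relation E u v = true  iff  there is an edge u → v.
Graph : ℕ → Set
Graph m = Fin m → Fin m → Bool

module _ {m : ℕ} (E : Graph m) where

  indeg : Fin m → ℕ
  indeg v = length (filter (λ u → E u v ≟B true) (allFin m))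

  outdeg : Fin m → ℕ
  outdeg u = length (filter (λ v → E u v ≟B true) (allFin m))

  data Path⁺ : Fin m → Fin m → Set where
    edge : ∀ {u v} → E u v ≡ true → Path⁺ u v
    cons : ∀ {u v w} → E u v ≡ true → Path⁺ v w → Path⁺ u w

  Reach : Fin m → Fin m → Set
  Reach u v = (u ≡ v) ⊎ Path⁺ u v

  Acyclic : Set
  Acyclic = ∀ v → ¬ Path⁺ v v

  IsLeaf : Fin m → Set
  IsLeaf v = indeg v ≡ 1 × outdeg v ≡ 0

  -- tree node: the root (the unique node of indegree 0) or indegree 1 and outdegree ≥ 2
  IsTreeNode : Fin m → Set
  IsTreeNode v = indeg v ≡ 0 ⊎ (indeg v ≡ 1 × 2 ≤ outdeg v)

  IsReticulate : Fin m → Set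
  IsReticulate v = 2 ≤ indeg v × outdeg v ≡ 1

  IsRedundant : Fin m → Set
  IsRedundant v = indeg v ≡ 1 × outdeg v ≡ 1

  data Conn (P : Fin m → Set) : Fin m → Fin m → Set where
    here : ∀ {v} → P v → Conn P v v
    step : ∀ {u v w} → Conn P u v → P w → (E v w ≡ true ⊎ E w v ≡ true) → Conn P u w

  -- the subgraph induced by P has exactly k connected components:
  -- there is a surjective labelling of the nodes of P by Fin k whose
  -- fibres are exactly the connected components.
  NumComponents : (Fin m → Set) → ℕ → Set
  NumComponents P k =
    Σ ((v : Fin m) → P v → Fin k) λ c →
      (∀ (i : Fin k) → ∃ λ v → Σ (P v) λ pv → c v pv ≡ i)
      × (∀ u v (pu : P u) (pv : P v) → (c u pu ≡ c v pv) ⇔ Conn P u v)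

record RPN (n m : ℕ) : Set where
  field
    E        : Graph m
    acyclic  : Acyclic E
    root     : Fin m
    root-in0 : indeg E root ≡ 0
    root-unique : ∀ v → indeg E v ≡ 0 → v ≡ root
    root-out : 1 ≤ outdeg E root
    rooted   : ∀ v → Reach E root v
    nonroot  : ∀ v → ¬ (v ≡ root) → indeg E v ≡ 1 ⊎ outdeg E v ≡ 1
    label    : Fin n → Fin m
    label-inj  : ∀ x y → label x ≡ label y → x ≡ y
    label-leaf : ∀ x → IsLeaf E (label x)
    label-onto : ∀ v → IsLeaf E v → ∃ λ x → label x ≡ v

module Submission where

open import Defs
open import Data.Nat using (ℕ; _+_; _≤_)
open import Data.Fin using (Fin)
open import Data.Product using (_×_)
open import Relation.Nullary using (¬_)

open import Data.Nat using (zero; suc; z≤n; s≤s)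
import Data.Nat.Properties as ℕₚ
open import Data.Fin using (zero; join; splitAt)
open import Data.Fin.Properties using (injective⇒≤; splitAt-join; join-splitAt; any?)
import Data.Fin.Properties as Finₚ
open import Data.Fin.Induction using (spo-wellFounded)
open import Data.Bool using (Bool; true)
open import Data.Bool.Properties using () renaming (_≟_ to _≟B_)
open import Data.List using (List; []; _∷_; filter; length)
open import Data.List.Base using (allFin)
open import Data.List.Membership.Propositional using (_∈_)
open import Data.List.Membership.Propositional.Properties using (∈-filter⁺; ∈-filter⁻; ∈-allFin)
open import Data.List.Relation.Unary.Any using (here)
open import Data.Product using (Σ; ∃; _,_; proj₁; proj₂)
open import Data.Sum using (_⊎_; inj₁; inj₂)
open import Data.Sum.Properties using (inj₁-injective; inj₂-injective)
open import Data.Empty using (⊥; ⊥-elim)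
open import Function.Base using (flip; _∘_)
open import Function.Bundles using (mk⇔; Equivalence)
open import Induction.WellFounded using (Acc; acc; WellFounded)
open import Relation.Binary.PropositionalEquality using (_≡_; refl; sym; trans; cong; subst; isEquivalence)
open import Relation.Binary.Structures using (IsStrictPartialOrder)
open import Relation.Nullary using (Dec; yes; no)
open import Relation.Nullary.Decidable using (_×-dec_)
open import Relation.Unary using (Decidable)

-- In a network without redundant nodes every tree node other
-- than the root has exactly one parent, and every reticulate node exactly
-- one child.  Hence every tree-node component has a unique "top" (a node
-- with no parent inside the component), and every reticulation component a
-- unique "bottom" (top in the reversed graph).  We then build two injections:
--   * tree components → reticulation components + {root component}: a
--     non-root component is sent to the reticulation component containing
--     the (reticulate) parent of its top; this gives p ≤ q + 1;
--   * reticulation components + {root component} → leaves + tree components: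
--     a reticulation component is sent to the child of its bottom, which is
--     a leaf or the top of a tree component; this gives q + 1 ≤ n + p.
-- The file first develops degree counting, paths and flipped graphs, then
-- the theory of tops of components in any acyclic graph whose chosen nodes
-- have unique parents, then specialises it to RPNs and assembles the bounds.

injection⇒≤ : ∀ {a c d} (f : Fin a → Fin c ⊎ Fin d) →
              (∀ {x y} → f x ≡ f y → x ≡ y) → a ≤ c + d
injection⇒≤ {c = c} {d} f f-inj =
  injective⇒≤ {f = join c d ∘ f} (f-inj ∘ join-injective)
  where
  join-injective : ∀ {x y} → join c d x ≡ join c d y → x ≡ y
  join-injective {x} {y} eq =
    trans (sym (splitAt-join c d x)) (trans (cong (splitAt c) eq) (splitAt-join c d y))

injection-from-sum⇒≤ : ∀ {a b c d} (f : Fin a ⊎ Fin b → Fin c ⊎ Fin d) →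
                       (∀ {x y} → f x ≡ f y → x ≡ y) → a + b ≤ c + d
injection-from-sum⇒≤ {a} {b} f f-inj = injection⇒≤ (f ∘ splitAt a) splitAt-injective
  where
  splitAt-injective : ∀ {x y} → f (splitAt a x) ≡ f (splitAt a y) → x ≡ y
  splitAt-injective {x} {y} eq =
    trans (sym (join-splitAt a b x)) (trans (cong (join a b) (f-inj eq)) (join-splitAt a b y))

∈⇒length-positive : ∀ {A : Set} {x : A} {xs : List A} → x ∈ xs → 1 ≤ length xs
∈⇒length-positive {xs = _ ∷ _} _ = s≤s z≤n

length-positive⇒∈ : ∀ {A : Set} {xs : List A} → 1 ≤ length xs → ∃ λ x → x ∈ xs
length-positive⇒∈ {xs = x ∷ _} _ = x , here refl

length-one⇒∈-unique : ∀ {A : Set} {x y : A} {xs : List A} → length xs ≡ 1 → x ∈ xs → y ∈ xs → x ≡ y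
length-one⇒∈-unique {xs = _ ∷ []} _ (here x≡a) (here y≡a) = trans x≡a (sym y≡a)

module Filtered {m : ℕ} (f : Fin m → Bool) where

  members : List (Fin m)
  members = filter (λ u → f u ≟B true) (allFin m)

  member : ∀ {u} → f u ≡ true → u ∈ members
  member {u} fu = ∈-filter⁺ (λ u → f u ≟B true) (∈-allFin u) fu

  sound : ∀ {u} → u ∈ members → f u ≡ true
  sound u∈ = proj₂ (∈-filter⁻ (λ u → f u ≟B true) {xs = allFin m} u∈)

  count-positive : ∀ {u} → f u ≡ true → 1 ≤ length members
  count-positive = ∈⇒length-positive ∘ member

  witness : 1 ≤ length members → ∃ λ u → f u ≡ true
  witness pos = let u , u∈ = length-positive⇒∈ pos in u , sound u∈

  count-one-unique : length members ≡ 1 → ∀ {x y} → f x ≡ true → f y ≡ true → x ≡ y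
  count-one-unique one fx fy = length-one⇒∈-unique one (member fx) (member fy)

-- In-degree facts; since outdeg E u is definitionally indeg (flip E) u, the
-- same lemmas applied to the reversed graph give the out-degree facts.
module Degrees {m : ℕ} (E : Graph m) where

  has-parent⇒indeg-positive : ∀ {u v} → E u v ≡ true → 1 ≤ indeg E v
  has-parent⇒indeg-positive {v = v} = Filtered.count-positive (λ u → E u v)

  indeg-positive⇒has-parent : ∀ {v} → 1 ≤ indeg E v → ∃ λ u → E u v ≡ true
  indeg-positive⇒has-parent {v} = Filtered.witness (λ u → E u v)

  indeg-one⇒parent-unique : ∀ {v} → indeg E v ≡ 1 → ∀ {x y} → E x v ≡ true → E y v ≡ true → x ≡ y
  indeg-one⇒parent-unique {v} = Filtered.count-one-unique (λ u → E u v)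

path-trans : ∀ {m} {E : Graph m} {x y z} → Path⁺ E x y → Path⁺ E y z → Path⁺ E x z
path-trans (edge e) q = cons e q
path-trans (cons e p) q = cons e (path-trans p q)

path-reverse : ∀ {m} {E : Graph m} {u v} → Path⁺ (flip E) u v → Path⁺ E v u
path-reverse (edge e) = edge e
path-reverse (cons e p) = path-trans (path-reverse p) (edge e)

acyclic-flip : ∀ {m} {E : Graph m} → Acyclic E → Acyclic (flip E)
acyclic-flip acyclic v = acyclic v ∘ path-reverse

ancestors-wellFounded : ∀ {m} {E : Graph m} → Acyclic E → WellFounded (Path⁺ E)
ancestors-wellFounded {E = E} acyclic = spo-wellFounded ancestor-order
  where
  ancestor-order : IsStrictPartialOrder _≡_ (Path⁺ E)
  ancestor-order = record
    { isEquivalence = isEquivalence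
    ; irrefl = λ { refl p → acyclic _ p }
    ; trans = path-trans
    ; <-resp-≈ = (λ { refl p → p }) , (λ { refl p → p })
    }

-- Connectivity ignores edge directions, so reversing the graph changes
-- neither connectivity nor the component count.
conn-flip : ∀ {m} {E : Graph m} {P : Fin m → Set} {u v} → Conn E P u v → Conn (flip E) P u v
conn-flip (here p) = here p
conn-flip (step c p (inj₁ e)) = step (conn-flip c) p (inj₂ e)
conn-flip (step c p (inj₂ e)) = step (conn-flip c) p (inj₁ e)

components-flip : ∀ {m} {E : Graph m} {P : Fin m → Set} {k} →
                  NumComponents E P k → NumComponents (flip E) P k
components-flip (class , onto , same⇔conn) =
  class , onto , λ u v pu pv →
    let open Equivalence (same⇔conn u v pu pv) in mk⇔ (conn-flip ∘ to) (from ∘ conn-flip)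

module Components {m} {E : Graph m} {P : Fin m → Set} {k} (NC : NumComponents E P k) where

  class : (v : Fin m) → P v → Fin k
  class = proj₁ NC

  class-onto : ∀ i → ∃ λ v → Σ (P v) λ pv → class v pv ≡ i
  class-onto = proj₁ (proj₂ NC)

  same-class⇒conn : ∀ {u v} (pu : P u) (pv : P v) → class u pu ≡ class v pv → Conn E P u v
  same-class⇒conn pu pv = Equivalence.to (proj₂ (proj₂ NC) _ _ pu pv)

  conn⇒same-class : ∀ {u v} (pu : P u) (pv : P v) → Conn E P u v → class u pu ≡ class v pv
  conn⇒same-class pu pv = Equivalence.from (proj₂ (proj₂ NC) _ _ pu pv)

  class-irrelevant : ∀ {u v} (pu : P u) (pv : P v) → u ≡ v → class u pu ≡ class v pv
  class-irrelevant pu pv refl = conn⇒same-class pu pv (here pu)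

module ComponentTops {m : ℕ} (G : Graph m) (P : Fin m → Set) (P? : Decidable P)
    (acyclic : Acyclic G)
    (parent-unique : ∀ {x y z} → P z → G x z ≡ true → G y z ≡ true → x ≡ y) where

  Top : Fin m → Set
  Top t = ∀ y → P y → G y t ≡ true → ⊥

  conn-end : ∀ {u v} → Conn G P u v → P v
  conn-end (here p) = p
  conn-end (step _ p _) = p

  -- climbing through P-parents terminates (acyclicity) at a top
  top-above : ∀ v → P v → ∃ λ t → P t × Top t × Conn G P t v
  top-above v = climb v (ancestors-wellFounded acyclic v)
    where
    climb : ∀ v → Acc (Path⁺ G) v → P v → ∃ λ t → P t × Top t × Conn G P t v
    climb v (acc ancestor) pv with any? (λ y → P? y ×-dec (G y v ≟B true))
    ... | no no-parent = v , pv , (λ y py e → no-parent (y , py , e)) , here pv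
    ... | yes (y , py , e) =
      let t , pt , t-top , t~y = climb y (ancestor (edge e)) py
      in t , pt , t-top , step t~y pv (inj₁ e)

  data Below (t : Fin m) : Fin m → Set where
    start  : Below t t
    extend : ∀ {x v} → Below t x → P x → G x v ≡ true → Below t v

  -- from a top, every connection inside P is a downward path: an upward
  -- step in a connection must retrace the unique parent
  conn-from-top⇒below : ∀ {t v} → Top t → Conn G P t v → Below t v
  conn-from-top⇒below t-top (here _) = start
  conn-from-top⇒below t-top (step c _ (inj₁ e)) = extend (conn-from-top⇒below t-top c) (conn-end c) e
  conn-from-top⇒below t-top (step c pw (inj₂ e)) with conn-from-top⇒below t-top c
  ... | start = ⊥-elim (t-top _ pw e)
  ... | extend below _ e′ = subst (Below _) (parent-unique (conn-end c) e′ e) below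

  top-unique : ∀ {t t′} → Top t → Top t′ → Conn G P t t′ → t ≡ t′
  top-unique t-top t′-top c with conn-from-top⇒below t-top c
  ... | start = refl
  ... | extend {x} _ px e = ⊥-elim (t′-top x px e)

  module Labelled {k} (NC : NumComponents G P k) where
    open Components NC

    record ComponentTop (i : Fin k) : Set where
      field
        node     : Fin m
        inP      : P node
        top      : Top node
        labelled : class node inP ≡ i

    component-top : ∀ i → ComponentTop i
    component-top i =
      let v , pv , v-class = class-onto i
          t , pt , t-top , t~v = top-above v pv
      in record { node = t ; inP = pt ; top = t-top
                ; labelled = trans (conn⇒same-class pt pv t~v) v-class }

    top-injective : ∀ {t t′} (pt : P t) (pt′ : P t′) → Top t → Top t′ →
                    class t pt ≡ class t′ pt′ → t ≡ t′
    top-injective pt pt′ t-top t′-top same = top-unique t-top t′-top (same-class⇒conn pt pt′ same)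

positive≢zero : ∀ {k} → 1 ≤ k → ¬ k ≡ 0
positive≢zero (s≤s _) ()

-- Degree arithmetic behind the classification of non-root nodes: indegree
-- at least 1, indegree or outdegree equal to 1, but not both (not redundant)
-- means leaf, tree node with one parent, or reticulate node.
degree-cases : ∀ a b → 1 ≤ a → (a ≡ 1 ⊎ b ≡ 1) → ¬ (a ≡ 1 × b ≡ 1) →
               (a ≡ 1 × b ≡ 0) ⊎ (a ≡ 1 × 2 ≤ b) ⊎ (2 ≤ a × b ≡ 1)
degree-cases 1 0 _ _ _ = inj₁ (refl , refl)
degree-cases 1 1 _ _ not-redundant = ⊥-elim (not-redundant (refl , refl))
degree-cases 1 (suc (suc b)) _ _ _ = inj₂ (inj₁ (refl , s≤s (s≤s z≤n)))
degree-cases (suc (suc a)) b _ (inj₂ b≡1) _ = inj₂ (inj₂ (s≤s (s≤s z≤n) , b≡1))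

module Network {n m : ℕ} (N : RPN n m) (no-redundant : ∀ v → ¬ IsRedundant (RPN.E N) v) where
  open RPN N
  open Degrees E
  open Degrees (flip E) using () renaming
    ( has-parent⇒indeg-positive to has-child⇒outdeg-positive
    ; indeg-positive⇒has-parent to outdeg-positive⇒has-child
    ; indeg-one⇒parent-unique to outdeg-one⇒child-unique )

  T R : Fin m → Set
  T = IsTreeNode E
  R = IsReticulate E

  T? : Decidable T
  T? v with indeg E v ℕₚ.≟ 0 | (indeg E v ℕₚ.≟ 1) ×-dec (2 ℕₚ.≤? outdeg E v)
  ... | yes root-like | _ = yes (inj₁ root-like)
  ... | no _ | yes inner = yes (inj₂ inner)
  ... | no ¬root-like | no ¬inner = no λ { (inj₁ x) → ¬root-like x ; (inj₂ x) → ¬inner x }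

  R? : Decidable R
  R? v = (2 ℕₚ.≤? indeg E v) ×-dec (outdeg E v ℕₚ.≟ 1)

  tree-not-reticulate : ∀ {v} → T v → ¬ R v
  tree-not-reticulate (inj₁ indeg≡0) (2≤indeg , _) = positive≢zero (ℕₚ.≤-trans (s≤s z≤n) 2≤indeg) indeg≡0
  tree-not-reticulate (inj₂ (indeg≡1 , _)) (2≤indeg , _) = ℕₚ.<-irrefl refl (subst (2 ≤_) indeg≡1 2≤indeg)

  root-tree : T root
  root-tree = inj₁ root-in0

  root-has-no-parent : ∀ {u} → E u root ≡ true → ⊥
  root-has-no-parent e = positive≢zero (has-parent⇒indeg-positive e) root-in0

  has-parent⇒non-root : ∀ {u v} → E u v ≡ true → ¬ v ≡ root
  has-parent⇒non-root e refl = root-has-no-parent e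

  non-root-indeg-positive : ∀ {v} → ¬ v ≡ root → 1 ≤ indeg E v
  non-root-indeg-positive {v} v≢root with indeg E v | root-unique v
  ... | zero | unique = ⊥-elim (v≢root (unique refl))
  ... | suc _ | _ = s≤s z≤n

  classify : ∀ {v} → ¬ v ≡ root → IsLeaf E v ⊎ (indeg E v ≡ 1 × 2 ≤ outdeg E v) ⊎ R v
  classify {v} v≢root =
    degree-cases (indeg E v) (outdeg E v) (non-root-indeg-positive v≢root) (nonroot v v≢root) (no-redundant v)

  tree-parent-unique : ∀ {x y z} → T z → E x z ≡ true → E y z ≡ true → x ≡ y
  tree-parent-unique (inj₁ indeg≡0) ex _ = ⊥-elim (positive≢zero (has-parent⇒indeg-positive ex) indeg≡0)
  tree-parent-unique (inj₂ (indeg≡1 , _)) = indeg-one⇒parent-unique indeg≡1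

  reticulate-child-unique : ∀ {x y z} → R z → E z x ≡ true → E z y ≡ true → x ≡ y
  reticulate-child-unique (_ , outdeg≡1) = outdeg-one⇒child-unique outdeg≡1

  -- tops of tree components, and bottoms of reticulation components (tops
  -- in the reversed graph: reticulate nodes without reticulate child)
  module Tree = ComponentTops E T T? acyclic tree-parent-unique
  module Ret = ComponentTops (flip E) R R? (acyclic-flip acyclic) reticulate-child-unique

  root-top : Tree.Top root
  root-top _ _ = root-has-no-parent

  non-reticulate-child : ∀ {u w} → E u w ≡ true → ¬ R w → indeg E w ≡ 1 × (IsLeaf E w ⊎ T w)
  non-reticulate-child e ¬ret with classify (has-parent⇒non-root e)
  ... | inj₁ leaf = proj₁ leaf , inj₁ leaf
  ... | inj₂ (inj₁ inner) = proj₁ inner , inj₂ (inj₂ inner)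
  ... | inj₂ (inj₂ ret) = ⊥-elim (¬ret ret)

  reticulate-parent⇒top : ∀ {r w} → R r → E r w ≡ true → indeg E w ≡ 1 → Tree.Top w
  reticulate-parent⇒top r-ret e indeg≡1 y y-tree e′ =
    tree-not-reticulate y-tree (subst R (indeg-one⇒parent-unique indeg≡1 e e′) r-ret)

  -- a parent of a node that is not itself a tree node must be reticulate
  -- (it has a child, so it is not a leaf, and it is not redundant)
  non-tree-parent⇒reticulate : ∀ {u t} → E u t ≡ true → ¬ T u → R u
  non-tree-parent⇒reticulate {u} e ¬tree with u Finₚ.≟ root
  ... | yes refl = ⊥-elim (¬tree root-tree)
  ... | no u≢root with classify u≢root
  ...   | inj₁ (_ , outdeg≡0) = ⊥-elim (positive≢zero (has-child⇒outdeg-positive e) outdeg≡0)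
  ...   | inj₂ (inj₁ inner) = ⊥-elim (¬tree (inj₂ inner))
  ...   | inj₂ (inj₂ ret) = ret

  tree-child⇒bottom : ∀ {u t} → R u → E u t ≡ true → T t → Ret.Top u
  tree-child⇒bottom u-ret e t-tree y y-ret e′ =
    tree-not-reticulate t-tree (subst R (reticulate-child-unique u-ret e′ e) y-ret)

  -- where an exit edge of a reticulation component can land
  Entry : Fin m → Set
  Entry w = IsLeaf E w ⊎ (T w × Tree.Top w)

  root-entry : Entry root
  root-entry = inj₂ (root-tree , root-top)

  module Bounds {p q : ℕ} (NT : NumComponents E T p) (NR : NumComponents E R q) where
    module TC = Components NT
    module RC = Components NR
    module Tops = Tree.Labelled NT
    module Bottoms = Ret.Labelled (components-flip NR)

    root-class : Fin p
    root-class = TC.class root root-tree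

    -- q + 1 ≤ n + p: send each reticulation component to where its bottom
    -- exits (a leaf or a tree component), and the extra point to the root's
    -- component

    record Outlet (j : Fin q) : Set where
      field
        bottom        : Fin m
        bottom-ret    : R bottom
        labelled      : RC.class bottom bottom-ret ≡ j
        exit          : Fin m
        exits         : E bottom exit ≡ true
        single-parent : indeg E exit ≡ 1
        entry         : Entry exit

    outlet : ∀ j → Outlet j
    outlet j = record
      { bottom = r ; bottom-ret = r-ret ; labelled = r-labelled
      ; exit = w ; exits = e ; single-parent = proj₁ w-kind ; entry = entry (proj₂ w-kind) }
      where
      open Bottoms.ComponentTop (Bottoms.component-top j) renaming
        (node to r; inP to r-ret; top to r-bottom; labelled to r-labelled)
      w-and-e : ∃ λ w → E r w ≡ true
      w-and-e = outdeg-positive⇒has-child (ℕₚ.≤-reflexive (sym (proj₂ r-ret)))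
      w : Fin m
      w = proj₁ w-and-e
      e : E r w ≡ true
      e = proj₂ w-and-e
      w-kind : indeg E w ≡ 1 × (IsLeaf E w ⊎ T w)
      w-kind = non-reticulate-child e (λ w-ret → r-bottom w w-ret e)
      entry : IsLeaf E w ⊎ T w → Entry w
      entry (inj₁ leaf) = inj₁ leaf
      entry (inj₂ tree) = inj₂ (tree , reticulate-parent⇒top r-ret e (proj₁ w-kind))

    -- the exit determines the reticulation component (its unique parent is the bottom)
    outlet-injective : ∀ {j j′} (o : Outlet j) (o′ : Outlet j′) → Outlet.exit o ≡ Outlet.exit o′ → j ≡ j′
    outlet-injective o o′ same-exit =
      trans (sym (labelled o)) (trans (RC.class-irrelevant _ _ same-bottom) (labelled o′))
      where
      open Outlet
      same-bottom : bottom o ≡ bottom o′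
      same-bottom = indeg-one⇒parent-unique (single-parent o) (exits o)
                      (subst (λ w → E (bottom o′) w ≡ true) (sym same-exit) (exits o′))

    target : ∀ w → Entry w → Fin n ⊎ Fin p
    target w (inj₁ leaf) = inj₁ (proj₁ (label-onto w leaf))
    target w (inj₂ (tree , _)) = inj₂ (TC.class w tree)

    -- leaves are labelled injectively and tree components have unique tops
    target-injective : ∀ {w w′} (a : Entry w) (a′ : Entry w′) → target w a ≡ target w′ a′ → w ≡ w′
    target-injective (inj₁ leaf) (inj₁ leaf′) eq =
      trans (sym (proj₂ (label-onto _ leaf)))
            (trans (cong label (inj₁-injective eq)) (proj₂ (label-onto _ leaf′)))
    target-injective (inj₂ (tree , top)) (inj₂ (tree′ , top′)) eq =
      Tops.top-injective tree tree′ top top′ (inj₂-injective eq)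

    upper-map : Fin q ⊎ Fin 1 → Fin n ⊎ Fin p
    upper-map (inj₁ j) = target _ (Outlet.entry (outlet j))
    upper-map (inj₂ _) = target root root-entry

    upper-map-injective : ∀ {x y} → upper-map x ≡ upper-map y → x ≡ y
    upper-map-injective {inj₁ j} {inj₁ j′} eq =
      cong inj₁ (outlet-injective (outlet j) (outlet j′) (target-injective _ _ eq))
    upper-map-injective {inj₁ j} {inj₂ _} eq =
      ⊥-elim (has-parent⇒non-root (Outlet.exits (outlet j))
                (target-injective (Outlet.entry (outlet j)) root-entry eq))
    upper-map-injective {inj₂ _} {inj₁ j} eq =
      ⊥-elim (has-parent⇒non-root (Outlet.exits (outlet j))
                (target-injective (Outlet.entry (outlet j)) root-entry (sym eq)))
    upper-map-injective {inj₂ zero} {inj₂ zero} _ = refl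

    upper-bound : q + 1 ≤ n + p
    upper-bound = injection-from-sum⇒≤ upper-map upper-map-injective

    -- p ≤ q + 1: the top of a non-root tree component has a reticulate parent,
    -- which is a bottom; send the component to that reticulation component,
    -- and the root's component to the extra point

    record Inlet (i : Fin p) : Set where
      field
        top        : Fin m
        top-tree   : T top
        labelled   : TC.class top top-tree ≡ i
        parent     : Fin m
        enters     : E parent top ≡ true
        parent-ret : R parent

    inlet : ∀ i → ¬ i ≡ root-class → Inlet i
    inlet i i≢root-class = record
      { top = t ; top-tree = t-tree ; labelled = t-labelled
      ; parent = u ; enters = e
      ; parent-ret = non-tree-parent⇒reticulate e (λ u-tree → t-top u u-tree e) }
      where
      open Tops.ComponentTop (Tops.component-top i) renaming
        (node to t; inP to t-tree; top to t-top; labelled to t-labelled)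
      t≢root : ¬ t ≡ root
      t≢root t≡root = i≢root-class (trans (sym t-labelled) (TC.class-irrelevant t-tree root-tree t≡root))
      u-and-e : ∃ λ u → E u t ≡ true
      u-and-e = indeg-positive⇒has-parent (non-root-indeg-positive t≢root)
      u : Fin m
      u = proj₁ u-and-e
      e : E u t ≡ true
      e = proj₂ u-and-e

    -- the bottom determines its unique child, hence the tree component
    inlet-injective : ∀ {i i′} (o : Inlet i) (o′ : Inlet i′) →
                      RC.class (Inlet.parent o) (Inlet.parent-ret o) ≡ RC.class (Inlet.parent o′) (Inlet.parent-ret o′) →
                      i ≡ i′
    inlet-injective o o′ same-class =
      trans (sym (labelled o)) (trans (TC.class-irrelevant _ _ same-top) (labelled o′))
      where
      open Inlet
      bottom : ∀ {i} (o : Inlet i) → Ret.Top (parent o)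
      bottom o = tree-child⇒bottom (parent-ret o) (enters o) (top-tree o)
      same-parent : parent o ≡ parent o′
      same-parent = Bottoms.top-injective (parent-ret o) (parent-ret o′) (bottom o) (bottom o′) same-class
      same-top : top o ≡ top o′
      same-top = reticulate-child-unique (parent-ret o) (enters o)
                   (subst (λ u → E u (top o′) ≡ true) (sym same-parent) (enters o′))

    lower-choice : (i : Fin p) → Dec (i ≡ root-class) → Fin q ⊎ Fin 1
    lower-choice i (yes _) = inj₂ zero
    lower-choice i (no i≢root-class) = inj₁ (RC.class _ (Inlet.parent-ret (inlet i i≢root-class)))

    lower-choice-injective : ∀ i i′ d d′ → lower-choice i d ≡ lower-choice i′ d′ → i ≡ i′
    lower-choice-injective i i′ (yes i≡root) (yes i′≡root) _ = trans i≡root (sym i′≡root)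
    lower-choice-injective i i′ (no i≢root) (no i′≢root) eq =
      inlet-injective (inlet i i≢root) (inlet i′ i′≢root) (inj₁-injective eq)

    lower-map : Fin p → Fin q ⊎ Fin 1
    lower-map i = lower-choice i (i Finₚ.≟ root-class)

    lower-bound : p ≤ q + 1
    lower-bound = injection⇒≤ lower-map (λ {i} {i′} → lower-choice-injective i i′ _ _)

proposition3p1 : ∀ (n m : ℕ) (N : RPN n m) → (∀ v → ¬ IsRedundant (RPN.E N) v) →
    ∀ (p q : ℕ) → NumComponents (RPN.E N) (IsTreeNode (RPN.E N)) p →
    NumComponents (RPN.E N) (IsReticulate (RPN.E N)) q →
    (p ≤ q + 1) × (q + 1 ≤ n + p)
proposition3p1 n m N no-redundant p q NT NR = lower-bound , upper-bound
  where open Network.Bounds N no-redundant NT NR
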